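{- Let $k$ and $j$ be integers with $2\leq j\leq \frac{k}{2}$, and let $\Xi=k+1-2j$. Let $S$ be a symmetric subset of $\{1,2,\dotsc,k\}$ (i.e., $l\in S$ if and only if $k+1-l\in S$) such that $1\in S$ and $j\notin S$, and suppose $S$ contains an integer $t$ with $t\equiv j\pmod{\Xi}$. Then $f\colon\mathbb{F}_2^k\to\mathbb{F}_2$ given by \[ f(x)=x_j\oplus(x_{k+1-j}\oplus 1)\prod_{l\in S}x_l \] is a $(k,n)$-lifting for every $n\geq k$.
   Context: A Boolean function $f\colon\mathbb{F}_2^k\to\mathbb{F}_2$ induces, for every $n\geq k$, the map $F\colon\mathbb{F}_2^n\to\mathbb{F}_2^n$ with $F(x)_i=f(x_i,\dotsc,x_{i+k-1})$ (indices mod $n$). $f$ has diameter $k$ if it depends on both $x_1$ and $x_k$; for $n\geq k$, $f$ is a $(k,n)$-lifting if it has diameter $k$ and this $F$ is bijective. -}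

module Defs where

open import Data.Nat using (ℕ; zero; suc; _+_; _∸_; _≤_)
open import Data.Nat.DivMod using (_mod_)
open import Data.Bool using (Bool; true; false; not; _∧_; _∨_; _xor_)
open import Data.Fin using (Fin; toℕ; fromℕ; opposite) renaming (zero to fzero)
open import Data.Vec using (Vec; lookup; tabulate; foldr′; zipWith; _[_]%=_)
open import Data.Product using (Σ; ∃; _×_)
open import Data.Empty using (⊥)
open import Relation.Binary.PropositionalEquality using (_≡_; _≢_)
open import Function.Definitions using (Bijective)

-- F₂ is modelled by Bool (⊕ = _xor_, multiplication = _∧_).
-- Inputs of f : F₂^k → F₂ are vectors Vec Bool k; the paper's coordinate x_l
-- (1 ≤ l ≤ k) is the entry at Fin-index l - 1.

-- 1-based access to coordinate l of x (only used for 1 ≤ l ≤ k).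
coord : {k : ℕ} → Vec Bool k → ℕ → Bool
coord {zero}  x l       = false
coord {suc k} x zero    = false
coord {suc k} x (suc l) = lookup x (l mod suc k)

DependsOn : {k : ℕ} → (Vec Bool k → Bool) → Fin k → Set
DependsOn f i = ∃ λ x → f x ≢ f (x [ i ]%= not)

HasDiameter : {k : ℕ} → (Vec Bool k → Bool) → Set
HasDiameter {zero}  f = ⊥
HasDiameter {suc m} f = DependsOn f fzero × DependsOn f (fromℕ m)

shift : {n : ℕ} → Fin n → ℕ → Fin n
shift {suc n} i m = (toℕ i + m) mod suc n

inducedMap : {k : ℕ} (n : ℕ) → (Vec Bool k → Bool) → Vec Bool n → Vec Bool n
inducedMap n f x = tabulate λ i → f (tabulate λ m → lookup x (shift i (toℕ m)))

IsLifting : (k n : ℕ) → (Vec Bool k → Bool) → Set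
IsLifting k n f = k ≤ n × HasDiameter f × Bijective _≡_ _≡_ (inducedMap n f)

-- Subsets of {1,…,k}: S : Vec Bool k, where l ∈ S iff the entry at index l-1 is true.
_∈ₗ_ : {k : ℕ} → ℕ → Vec Bool k → Set
_∈ₗ_ {k} l S = Σ (Fin k) λ i → (suc (toℕ i) ≡ l) × (lookup S i ≡ true)

-- symmetric: l ∈ S ↔ k+1-l ∈ S  (opposite i = k-1-i in 0-based indexing)
Symmetric : {k : ℕ} → Vec Bool k → Set
Symmetric {k} S = (i : Fin k) → lookup S i ≡ lookup S (opposite i)

prodOver : {k : ℕ} → Vec Bool k → Vec Bool k → Bool
prodOver S x = foldr′ _∧_ true (zipWith (λ s b → not s ∨ b) S x)

theF : (k j : ℕ) → Vec Bool k → Vec Bool k → Bool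
theF k j S x = coord x j xor ((coord x (k + 1 ∸ j) xor true) ∧ prodOver S x)

{-# OPTIONS --safe #-}

-- Write a = j − 1 and b = k − j = a + Ξ for the 0-based positions of x_j and x_{k+1−j}, and read a
-- configuration as an n-periodic sequence X, so that F X (q) = X (q+a) ⊕ ¬X (q+b) · Π_{l∈S} X (q+l).
-- If X (r+a+b) = 0, the symmetry of S kills every correction term of F in the window at r, so the
-- product of X over the window at r + a equals the product c_r of F X over the window at r. Hence
-- F X (r+a) = X (r+2a) ⊕ ¬X (r+2a+Ξ) · c_r, where c_r only depends on the image F X. Two preimages
-- that differ at r + 2a therefore differ at r + 2a + Ξ and have c_r = 1; iterating, they differ along
-- r + 2a + ℕΞ with c = 1 there. Since some t ∈ S has t ≡ j (mod Ξ), this makes F X = 1 along a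
-- progression, which in turn makes both preimages constant along r + 2a + ℕΞ (from some point on).
-- At one more point one of the two has a nonzero correction term, whose factor at position t
-- contradicts that constancy. So F is injective, hence bijective on the finite set F₂ⁿ.
-- For the diameter: x_1, x_k ∈ S are neither x_j nor x_{k+1−j}, and flipping either one changes f
-- at the point that is 1 everywhere except at x_{k+1−j} ∉ S.

module Submission where

open import Defs
open import Data.Nat using (ℕ; zero; suc; _+_; _*_; _∸_; _≤_; _<_; _%_; _/_; _^_; z≤n; s≤s; s≤s⁻¹; NonZero)
open import Data.Nat.Properties
  using ( suc-injective; +-identityʳ; +-assoc; +-comm; +-cancelˡ-≡; m+n∸m≡n; m+[n∸m]≡n; m∸n+n≡m
        ; m≤m+n; m≤n+m; ≤-trans; n<1+n; n≤1+n; +-monoʳ-≤; m<m+n; m<n+m; <-trans)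
  renaming (<⇒≢ to <⇒≢ℕ)
open import Data.Nat.DivMod using (_mod_; m≡m%n+[m/n]*n; m%n%n≡m%n; %-distribˡ-+; [m+n]%n≡m%n; m<n⇒m%n≡m; m≤n⇒m%n≡m; m%n<n)
open import Data.Nat.Tactic.RingSolver using (solve-∀)
open import Data.Bool using (Bool; true; false; not; _∧_; _xor_)
open import Data.Bool.Properties
  using (not-involutive; not-¬; ¬-not; ∧-identityʳ; xor-comm; xor-identityʳ) renaming (_≟_ to _≟ᴮ_)
import Data.Fin as Fin
open import Data.Fin using (Fin; toℕ; opposite; punchOut) renaming (zero to fzero; suc to fsuc)
open import Data.Fin.Properties
  using ( toℕ-injective; toℕ-fromℕ; toℕ-fromℕ<; fromℕ<-cong; toℕ<n; opposite-prop
        ; pigeonhole; punchOut-injective; any?; <⇒≢; 2↔Bool; _≟_)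
open import Data.Vec using (Vec; []; _∷_; lookup; tabulate; replicate; _[_]%=_)
open import Data.Vec.Properties
  using (lookup∘tabulate; tabulate-cong; tabulate∘lookup; lookup∘updateAt; lookup∘updateAt′; lookup-replicate)
open import Data.Vec.Recursive using (lift↔; Fin[m^n]↔Fin[m]^n)
open import Data.Vec.Recursive.Properties using (↔Vec)
open import Data.Product using (∃; ∃₂; _×_; _,_; proj₁; proj₂)
open import Data.Sum using (_⊎_; inj₁; inj₂; [_,_])
open import Data.Empty using (⊥; ⊥-elim)
open import Function using (_∘_)
open import Function.Bundles using (_↔_; Inverse)
open import Function.Properties.Inverse using (↔-sym; ↔-trans)
open import Function.Definitions using (Injective; StrictlySurjective; Surjective; Bijective)
open import Function.Consequences.Propositional using (strictlySurjective⇒surjective)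
open import Relation.Nullary using (¬_; yes; no)
open import Relation.Binary.PropositionalEquality
  using (_≡_; _≢_; _≗_; refl; sym; trans; cong; cong₂; subst; ≢-sym; module ≡-Reasoning)

open ≡-Reasoning

xor≡not-xor⇒≡not : ∀ x {p q} → x xor p ≡ not x xor q → q ≡ not p
xor≡not-xor⇒≡not false {p} {q} eq = trans (sym (not-involutive q)) (cong not (sym eq))
xor≡not-xor⇒≡not true eq = sym eq

xor≡not-xor⇒⊎ : ∀ x {p q} → x xor p ≡ not x xor q → p ≡ true ⊎ q ≡ true
xor≡not-xor⇒⊎ x {true}  eq = inj₁ refl
xor≡not-xor⇒⊎ x {false} eq = inj₂ (xor≡not-xor⇒≡not x eq)

not∧≡not[not∧]⇒ : ∀ y y′ {c} → not y′ ∧ c ≡ not (not y ∧ c) → y′ ≡ not y × c ≡ true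
not∧≡not[not∧]⇒ true  false         eq = refl , eq
not∧≡not[not∧]⇒ true  true          ()
not∧≡not[not∧]⇒ false true  {true}  eq = refl , refl
not∧≡not[not∧]⇒ false true  {false} ()
not∧≡not[not∧]⇒ false false {true}  ()
not∧≡not[not∧]⇒ false false {false} ()

xor-not≡true⇒≡ : ∀ x y → x xor not y ≡ true → x ≡ y
xor-not≡true⇒≡ false false _ = refl
xor-not≡true⇒≡ false true  ()
xor-not≡true⇒≡ true  false ()
xor-not≡true⇒≡ true  true  _ = refl

xor-true≡true⇒≡false : ∀ x → x xor true ≡ true → x ≡ false
xor-true≡true⇒≡false false _ = refl
xor-true≡true⇒≡false true  ()

x∧y≡true⇒y≡true : ∀ x {y} → x ∧ y ≡ true → y ≡ true
x∧y≡true⇒y≡true true eq = eq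

not∧-cong : ∀ y {p q} → (y ≡ false → p ≡ q) → not y ∧ p ≡ not y ∧ q
not∧-cong true  _  = refl
not∧-cong false eq = eq refl

stationary⇒constant : ∀ {ℓ} {A : Set ℓ} (s : ℕ → A) → (∀ m → s m ≡ s (suc m)) → ∀ m → s m ≡ s 0
stationary⇒constant s step zero    = refl
stationary⇒constant s step (suc m) = trans (sym (step m)) (stationary⇒constant s step m)

m%n≡o%n⇒m+[o/n]*n≡o+[m/n]*n : ∀ m o n .{{_ : NonZero n}} → m % n ≡ o % n → m + o / n * n ≡ o + m / n * n
m%n≡o%n⇒m+[o/n]*n≡o+[m/n]*n m o n eq = begin
  m + o / n * n                  ≡⟨ cong (_+ o / n * n) (m≡m%n+[m/n]*n m n) ⟩
  m % n + m / n * n + o / n * n  ≡⟨ cong (λ r → r + m / n * n + o / n * n) eq ⟩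
  o % n + m / n * n + o / n * n  ≡⟨ swap (o % n) (m / n * n) (o / n * n) ⟩
  o % n + o / n * n + m / n * n  ≡⟨ cong (_+ m / n * n) (m≡m%n+[m/n]*n o n) ⟨
  o + m / n * n                  ∎
  where
  swap : ∀ x y z → x + y + z ≡ x + z + y
  swap = solve-∀

Fin-injective⇒strictlySurjective : ∀ {N} (g : Fin N → Fin N) → Injective _≡_ _≡_ g → StrictlySurjective _≡_ g
Fin-injective⇒strictlySurjective {suc N} g g-inj y with any? (λ i → g i ≟ y)
... | yes hit = hit
... | no miss = ⊥-elim (collision (pigeonhole (n<1+n N) (λ i → punchOut (avoids i))))
  where
  avoids : ∀ i → y ≢ g i
  avoids i y≡gᵢ = miss (i , sym y≡gᵢ)
  collision : (∃₂ λ i j → i Fin.< j × punchOut (avoids i) ≡ punchOut (avoids j)) → ⊥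
  collision (i , j , i<j , eq) = <⇒≢ i<j (g-inj (punchOut-injective (avoids i) (avoids j) eq))

↔Fin-injective⇒strictlySurjective : ∀ {ℓ} {A : Set ℓ} {N} → A ↔ Fin N →
  (g : A → A) → Injective _≡_ _≡_ g → StrictlySurjective _≡_ g
↔Fin-injective⇒strictlySurjective A↔Fin g g-inj y = from (proj₁ hit) , to-injective (proj₂ hit)
  where
  open Inverse A↔Fin
  to-injective : Injective _≡_ _≡_ to
  to-injective {x} {x′} eq = trans (sym (strictlyInverseʳ x)) (trans (cong from eq) (strictlyInverseʳ x′))
  conj-injective : Injective _≡_ _≡_ (to ∘ g ∘ from)
  conj-injective {i} {i′} eq = begin
    i                ≡⟨ strictlyInverseˡ i ⟨
    to (from i)      ≡⟨ cong to (g-inj (to-injective eq)) ⟩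
    to (from i′)     ≡⟨ strictlyInverseˡ i′ ⟩
    i′               ∎
  hit : ∃ λ i → to (g (from i)) ≡ to y
  hit = Fin-injective⇒strictlySurjective (to ∘ g ∘ from) conj-injective (to y)

Vec-Bool↔Fin : ∀ n → Vec Bool n ↔ Fin (2 ^ n)
Vec-Bool↔Fin n = ↔-trans (↔-sym (↔Vec n)) (↔-trans (lift↔ n (↔-sym 2↔Bool)) (↔-sym (Fin[m^n]↔Fin[m]^n 2 n)))

Vec-Bool-injective⇒surjective : ∀ {n} (g : Vec Bool n → Vec Bool n) → Injective _≡_ _≡_ g → Surjective _≡_ _≡_ g
Vec-Bool-injective⇒surjective {n} g g-inj =
  strictlySurjective⇒surjective (↔Fin-injective⇒strictlySurjective (Vec-Bool↔Fin n) g g-inj)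

prodOver-true⇒ : ∀ {k} (S w : Vec Bool k) → prodOver S w ≡ true → ∀ i → lookup S i ≡ true → lookup w i ≡ true
prodOver-true⇒ (true  ∷ S) (true  ∷ w) eq fzero    _ = refl
prodOver-true⇒ (true  ∷ S) (true  ∷ w) eq (fsuc i)   = prodOver-true⇒ S w eq i
prodOver-true⇒ (true  ∷ S) (false ∷ w) ()
prodOver-true⇒ (false ∷ S) (x     ∷ w) eq fzero    ()
prodOver-true⇒ (false ∷ S) (x     ∷ w) eq (fsuc i)   = prodOver-true⇒ S w eq i

prodOver-true⇐ : ∀ {k} (S w : Vec Bool k) → (∀ i → lookup S i ≡ true → lookup w i ≡ true) → prodOver S w ≡ true
prodOver-true⇐ []          []          _ = refl
prodOver-true⇐ (false ∷ S) (x     ∷ w) h = prodOver-true⇐ S w (h ∘ fsuc)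
prodOver-true⇐ (true  ∷ S) (true  ∷ w) h = prodOver-true⇐ S w (h ∘ fsuc)
prodOver-true⇐ (true  ∷ S) (false ∷ w) h with () ← h fzero refl

prodOver-false : ∀ {k} (S w : Vec Bool k) i → lookup S i ≡ true → lookup w i ≡ false → prodOver S w ≡ false
prodOver-false S w i i∈S wᵢ≡false = ¬-not (λ prod≡true → not-¬ (prodOver-true⇒ S w prod≡true i i∈S) wᵢ≡false)

prodOver-cong : ∀ {k} (S w w′ : Vec Bool k) → (∀ i → lookup S i ≡ true → lookup w i ≡ lookup w′ i) →
  prodOver S w ≡ prodOver S w′
prodOver-cong []          []      []        _ = refl
prodOver-cong (false ∷ S) (_ ∷ w) (_ ∷ w′)  h = prodOver-cong S w w′ (h ∘ fsuc)
prodOver-cong (true  ∷ S) (_ ∷ w) (_ ∷ w′)  h = cong₂ _∧_ (h fzero refl) (prodOver-cong S w w′ (h ∘ fsuc))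

ReflectionClosed : ∀ {k} → Vec Bool k → ℕ → Set
ReflectionClosed S s = ∀ i → lookup S i ≡ true → ∃ λ i′ → lookup S i′ ≡ true × toℕ i + toℕ i′ ≡ s

toℕ-i+toℕ-opposite-i : ∀ {k} (i : Fin (suc k)) → toℕ i + toℕ (opposite i) ≡ k
toℕ-i+toℕ-opposite-i i = trans (cong (toℕ i +_) (opposite-prop i)) (m+[n∸m]≡n (s≤s⁻¹ (toℕ<n i)))

symmetric⇒reflectionClosed : ∀ {k} {S : Vec Bool (suc k)} → Symmetric S → ReflectionClosed S k
symmetric⇒reflectionClosed sym-S i i∈S = opposite i , trans (sym (sym-S i)) i∈S , toℕ-i+toℕ-opposite-i i

window : ∀ {k} → (ℕ → Bool) → ℕ → Vec Bool k
window X q = tabulate (λ m → X (q + toℕ m))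

lookup-window : ∀ {k} X q (i : Fin k) → lookup (window X q) i ≡ X (q + toℕ i)
lookup-window X q = lookup∘tabulate (λ m → X (q + toℕ m))

module Dynamics {k : ℕ} (S : Vec Bool k) (a Ξ : ℕ) where

  b : ℕ
  b = a + Ξ

  product : (ℕ → Bool) → ℕ → Bool
  product X q = prodOver S (window X q)

  correction : (ℕ → Bool) → ℕ → Bool
  correction X q = not (X (q + b)) ∧ product X q

  evolve : (ℕ → Bool) → ℕ → Bool
  evolve X q = X (q + a) xor correction X q

  product-true⇒ : ∀ X q → product X q ≡ true → ∀ i → lookup S i ≡ true → X (q + toℕ i) ≡ true
  product-true⇒ X q eq i i∈S = trans (sym (lookup-window X q i)) (prodOver-true⇒ S (window X q) eq i i∈S)

  product-cong : ∀ X Y q q′ → (∀ i → lookup S i ≡ true → X (q + toℕ i) ≡ Y (q′ + toℕ i)) → product X q ≡ product Y q′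
  product-cong X Y q q′ h = prodOver-cong S (window X q) (window Y q′) λ i i∈S →
    trans (lookup-window X q i) (trans (h i i∈S) (sym (lookup-window Y q′ i)))

  module _ (mirror : ReflectionClosed S (a + b)) where

    correction-vanishes : ∀ X r → X (r + a + b) ≡ false → ∀ i → lookup S i ≡ true → correction X (r + toℕ i) ≡ false
    correction-vanishes X r X≡false i i∈S with i′ , i′∈S , i+i′≡a+b ← mirror i i∈S =
      ¬-not λ correction≡true → not-¬ (X≡true correction≡true) X≡false
      where
      X≡true : correction X (r + toℕ i) ≡ true → X (r + a + b) ≡ true
      X≡true eq = begin
        X (r + a + b)              ≡⟨ cong X (+-assoc r a b) ⟩
        X (r + (a + b))            ≡⟨ cong (λ s → X (r + s)) i+i′≡a+b ⟨
        X (r + (toℕ i + toℕ i′))   ≡⟨ cong X (+-assoc r (toℕ i) (toℕ i′)) ⟨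
        X (r + toℕ i + toℕ i′)     ≡⟨ product-true⇒ X (r + toℕ i) (x∧y≡true⇒y≡true _ eq) i′ i′∈S ⟩
        true                       ∎

    product-shift : ∀ X r → X (r + a + b) ≡ false → product X (r + a) ≡ product (evolve X) r
    product-shift X r X≡false = product-cong X (evolve X) (r + a) r λ i i∈S → begin
      X (r + a + toℕ i)             ≡⟨ cong X (+-comm-middle r a (toℕ i)) ⟩
      X (r + toℕ i + a)             ≡⟨ xor-identityʳ _ ⟨
      X (r + toℕ i + a) xor false   ≡⟨ cong (X (r + toℕ i + a) xor_) (correction-vanishes X r X≡false i i∈S) ⟨
      evolve X (r + toℕ i)          ∎
      where
      +-comm-middle : ∀ x y z → x + y + z ≡ x + z + y
      +-comm-middle = solve-∀

    evolve-shift : ∀ X r → evolve X (r + a) ≡ X (r + a + a) xor (not (X (r + a + b)) ∧ product (evolve X) r)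
    evolve-shift X r = cong (X (r + a + a) xor_) (not∧-cong (X (r + a + b)) (product-shift X r))

    evolve-shift-true : ∀ Z s → product (evolve Z) s ≡ true → evolve Z (s + a) ≡ true → Z (s + a + a) ≡ Z (s + a + b)
    evolve-shift-true Z s prod≡true evolve≡true = xor-not≡true⇒≡ _ _ (begin
      Z (s + a + a) xor not y                                    ≡⟨ cong (Z (s + a + a) xor_) (∧-identityʳ (not y)) ⟨
      Z (s + a + a) xor (not y ∧ true)                           ≡⟨ cong (λ c → Z (s + a + a) xor (not y ∧ c)) prod≡true ⟨
      Z (s + a + a) xor (not y ∧ product (evolve Z) s)           ≡⟨ evolve-shift Z s ⟨
      evolve Z (s + a)                                           ≡⟨ evolve≡true ⟩
      true                                                       ∎)
      where
      y : Bool
      y = Z (s + a + b)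

    module Injectivity (X X′ : ℕ → Bool) (same-image : ∀ q → evolve X q ≡ evolve X′ q) where

      c : ℕ → Bool
      c r = product (evolve X) r

      c′≡c : ∀ r → product (evolve X′) r ≡ c r
      c′≡c r = product-cong (evolve X′) (evolve X) r r λ i _ → sym (same-image (r + toℕ i))

      Differ : ℕ → Set
      Differ r = X′ (r + a + a) ≡ not (X (r + a + a))

      differ-relation : ∀ r → Differ r →
        X (r + a + a) xor (not (X (r + a + b)) ∧ c r) ≡ not (X (r + a + a)) xor (not (X′ (r + a + b)) ∧ c r)
      differ-relation r d = begin
        X (r + a + a) xor (not (X (r + a + b)) ∧ c r)
          ≡⟨ evolve-shift X r ⟨
        evolve X (r + a)
          ≡⟨ same-image (r + a) ⟩
        evolve X′ (r + a)
          ≡⟨ evolve-shift X′ r ⟩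
        X′ (r + a + a) xor (not (X′ (r + a + b)) ∧ product (evolve X′) r)
          ≡⟨ cong₂ (λ x p → x xor (not (X′ (r + a + b)) ∧ p)) d (c′≡c r) ⟩
        not (X (r + a + a)) xor (not (X′ (r + a + b)) ∧ c r)
          ∎

      propagate : ∀ r → Differ r → Differ (r + Ξ) × c r ≡ true
      propagate r d with X′≡not-X , c≡true ← not∧≡not[not∧]⇒ (X (r + a + b)) (X′ (r + a + b))
                                               (xor≡not-xor⇒≡not (X (r + a + a)) (differ-relation r d))
        = subst (λ p → X′ p ≡ not (X p)) (reassoc r a Ξ) X′≡not-X , c≡true
        where
        reassoc : ∀ r a Ξ → r + a + (a + Ξ) ≡ r + Ξ + a + a
        reassoc = solve-∀

      module _ (t : Fin k) (t∈S : lookup S t ≡ true) (u v : ℕ) (t≡a : toℕ t + u * Ξ ≡ a + v * Ξ) where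

        module Chain (r : ℕ) (d : Differ r) where

          differ-along : ∀ m → Differ (r + m * Ξ)
          differ-along zero    = subst Differ (sym (+-identityʳ r)) d
          differ-along (suc m) = subst Differ (step r m Ξ) (proj₁ (propagate _ (differ-along m)))
            where
            step : ∀ r m Ξ → r + m * Ξ + Ξ ≡ r + suc m * Ξ
            step = solve-∀

          R : ℕ
          R = r + v * Ξ

          differ-from-R : ∀ m → Differ (R + m * Ξ)
          differ-from-R m = subst Differ (split r v m Ξ) (differ-along (v + m))
            where
            split : ∀ r v m Ξ → r + (v + m) * Ξ ≡ r + v * Ξ + m * Ξ
            split = solve-∀

          c-from-R : ∀ m → c (R + m * Ξ) ≡ true
          c-from-R m = proj₂ (propagate _ (differ-from-R m))

          -- c (r + (m + u) Ξ) = true puts a 1 of the image at r + (m + u) Ξ + t = R + m Ξ + a.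
          evolve-true : ∀ m → evolve X (R + m * Ξ + a) ≡ true
          evolve-true m = subst (λ q → evolve X q ≡ true) position
            (product-true⇒ (evolve X) (r + (m + u) * Ξ) (proj₂ (propagate _ (differ-along (m + u)))) t t∈S)
            where
            regroup : ∀ r m u Ξ t → r + (m + u) * Ξ + t ≡ r + m * Ξ + (t + u * Ξ)
            regroup = solve-∀
            regroup′ : ∀ r m v Ξ a → r + m * Ξ + (a + v * Ξ) ≡ r + v * Ξ + m * Ξ + a
            regroup′ = solve-∀
            position : r + (m + u) * Ξ + toℕ t ≡ R + m * Ξ + a
            position = begin
              r + (m + u) * Ξ + toℕ t       ≡⟨ regroup r m u Ξ (toℕ t) ⟩
              r + m * Ξ + (toℕ t + u * Ξ)   ≡⟨ cong (r + m * Ξ +_) t≡a ⟩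
              r + m * Ξ + (a + v * Ξ)       ≡⟨ regroup′ r m v Ξ a ⟩
              R + m * Ξ + a                 ∎

          g : ℕ → ℕ
          g m = R + m * Ξ + a + a

          stationary : ∀ Z → (∀ m → product (evolve Z) (R + m * Ξ) ≡ true) → (∀ m → evolve Z (R + m * Ξ + a) ≡ true) →
            ∀ m → Z (g m) ≡ Z (g (suc m))
          stationary Z prod≡true evolve≡true m =
            trans (evolve-shift-true Z (R + m * Ξ) (prod≡true m) (evolve≡true m)) (cong Z (next R m Ξ a))
            where
            next : ∀ R m Ξ a → R + m * Ξ + a + (a + Ξ) ≡ R + suc m * Ξ + a + a
            next = solve-∀

          p : ℕ
          p = R + u * Ξ + a

          -- If the correction fires at p while the image is 1 there, Z is 0 at g u but 1 at p + t = g v.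
          collapse : ∀ Z → (∀ m → Z (g m) ≡ Z (g (suc m))) → correction Z p ≡ true → evolve Z p ≡ true → ⊥
          collapse Z Z-stationary correction≡true evolve≡true = not-¬ Z[gv]≡true (trans Z[gv]≡Z[gu] Z[gu]≡false)
            where
            Z[gu]≡false : Z (g u) ≡ false
            Z[gu]≡false = xor-true≡true⇒≡false (Z (p + a)) (trans (cong (Z (p + a) xor_) (sym correction≡true)) evolve≡true)
            regroup : ∀ R u Ξ a t → R + u * Ξ + a + t ≡ R + a + (t + u * Ξ)
            regroup = solve-∀
            regroup′ : ∀ R v Ξ a → R + a + (a + v * Ξ) ≡ R + v * Ξ + a + a
            regroup′ = solve-∀
            position : p + toℕ t ≡ g v
            position = begin
              p + toℕ t                   ≡⟨ regroup R u Ξ a (toℕ t) ⟩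
              R + a + (toℕ t + u * Ξ)     ≡⟨ cong (R + a +_) t≡a ⟩
              R + a + (a + v * Ξ)         ≡⟨ regroup′ R v Ξ a ⟩
              g v                         ∎
            Z[gv]≡true : Z (g v) ≡ true
            Z[gv]≡true = subst (λ q → Z q ≡ true) position (product-true⇒ Z p (x∧y≡true⇒y≡true _ correction≡true) t t∈S)
            Z[gv]≡Z[gu] : Z (g v) ≡ Z (g u)
            Z[gv]≡Z[gu] = trans (stationary⇒constant (Z ∘ g) Z-stationary v)
                                (sym (stationary⇒constant (Z ∘ g) Z-stationary u))

          absurd : ⊥
          absurd =
            [ (λ correction≡true → collapse X X-stationary correction≡true (evolve-true u))
            , (λ correction′≡true → collapse X′ X′-stationary correction′≡true (trans (sym (same-image p)) (evolve-true u)))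
            ] (xor≡not-xor⇒⊎ (X (p + a)) (trans (same-image p) (cong (_xor correction X′ p) (differ-from-R u))))
            where
            X-stationary : ∀ m → X (g m) ≡ X (g (suc m))
            X-stationary = stationary X c-from-R evolve-true
            X′-stationary : ∀ m → X′ (g m) ≡ X′ (g (suc m))
            X′-stationary = stationary X′ (λ m → trans (c′≡c _) (c-from-R m))
                                          (λ m → trans (sym (same-image _)) (evolve-true m))

        agree-beyond : ∀ q → a + a ≤ q → X q ≡ X′ q
        agree-beyond q 2a≤q with X (q ∸ (a + a) + a + a) ≟ᴮ X′ (q ∸ (a + a) + a + a)
        ... | yes agree = subst (λ q → X q ≡ X′ q) (trans (+-assoc _ a a) (m∸n+n≡m 2a≤q)) agree
        ... | no differ = ⊥-elim (Chain.absurd (q ∸ (a + a)) (¬-not (≢-sym differ)))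

[m%n+o]%n≡[m+o]%n : ∀ m o n .{{_ : NonZero n}} → (m % n + o) % n ≡ (m + o) % n
[m%n+o]%n≡[m+o]%n m o n = begin
  (m % n + o) % n            ≡⟨ %-distribˡ-+ (m % n) o n ⟩
  (m % n % n + o % n) % n    ≡⟨ cong (λ x → (x + o % n) % n) (m%n%n≡m%n m n) ⟩
  (m % n + o % n) % n        ≡⟨ %-distribˡ-+ m o n ⟨
  (m + o) % n                ∎

toℕ-mod : ∀ {m k} → m ≤ k → toℕ (m mod suc k) ≡ m
toℕ-mod m≤k = trans (toℕ-fromℕ< _) (m≤n⇒m%n≡m m≤k)

periodic : ∀ {n} → Vec Bool (suc n) → ℕ → Bool
periodic {n} x p = lookup x (p mod suc n)

periodic-lookup : ∀ {n} (x : Vec Bool (suc n)) (i : Fin (suc n)) → periodic x (toℕ i + suc n) ≡ lookup x i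
periodic-lookup {n} x i = cong (lookup x) (toℕ-injective (begin
  toℕ ((toℕ i + suc n) mod suc n)   ≡⟨ toℕ-fromℕ< _ ⟩
  (toℕ i + suc n) % suc n           ≡⟨ [m+n]%n≡m%n (toℕ i) (suc n) ⟩
  toℕ i % suc n                     ≡⟨ m<n⇒m%n≡m (toℕ<n i) ⟩
  toℕ i                             ∎))

inducedMap-at : ∀ {n k} (f : Vec Bool k → Bool) (x : Vec Bool (suc n)) q →
  lookup (inducedMap (suc n) f x) (q mod suc n) ≡ f (window (periodic x) q)
inducedMap-at {n} f x q =
  trans (lookup∘tabulate (λ i → f (tabulate λ m → lookup x (shift i (toℕ m)))) (q mod suc n))
        (cong f (tabulate-cong λ m → cong (lookup x) (shift-mod (toℕ m))))
  where
  shift-mod : ∀ m → shift (q mod suc n) m ≡ (q + m) mod suc n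
  shift-mod m = fromℕ<-cong ((toℕ (q mod suc n) + m) % suc n) ((q + m) % suc n) (begin
    (toℕ (q mod suc n) + m) % suc n  ≡⟨ cong (λ r → (r + m) % suc n) (toℕ-fromℕ< (m%n<n q (suc n))) ⟩
    (q % suc n + m) % suc n          ≡⟨ [m%n+o]%n≡[m+o]%n q m (suc n) ⟩
    (q + m) % suc n                  ∎) _ _

localRule : ∀ {k} → Vec Bool k → Fin k → Fin k → Vec Bool k → Bool
localRule S ia ib w = lookup w ia xor (not (lookup w ib) ∧ prodOver S w)

module _ {k} (S : Vec Bool k) {a Ξ : ℕ} {ia ib : Fin k} (toℕ-ia : toℕ ia ≡ a) (toℕ-ib : toℕ ib ≡ a + Ξ) where
  open Dynamics S a Ξ

  localRule-window : ∀ X q → localRule S ia ib (window X q) ≡ evolve X q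
  localRule-window X q = cong₂ (λ x y → x xor (not y ∧ product X q)) (at ia toℕ-ia) (at ib toℕ-ib)
    where
    at : ∀ i {m} → toℕ i ≡ m → lookup (window X q) i ≡ X (q + m)
    at i refl = lookup-window X q i

  localRule-injective : ∀ {f} → f ≗ localRule S ia ib → ReflectionClosed S (a + b) →
    (t : Fin k) → lookup S t ≡ true → ∀ u v → toℕ t + u * Ξ ≡ a + v * Ξ →
    ∀ n → a + a ≤ n → Injective _≡_ _≡_ (inducedMap n f)
  localRule-injective f≗ mirror t t∈S u v t≡a zero    _ {[]} {[]} _ = refl
  localRule-injective {f} f≗ mirror t t∈S u v t≡a (suc n) 2a≤n {x} {x′} Fx≡Fx′ = begin
    x                    ≡⟨ tabulate∘lookup x ⟨
    tabulate (lookup x)  ≡⟨ tabulate-cong agree ⟩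
    tabulate (lookup x′) ≡⟨ tabulate∘lookup x′ ⟩
    x′                   ∎
    where
    evolve-periodic : ∀ y q → lookup (inducedMap (suc n) f y) (q mod suc n) ≡ evolve (periodic y) q
    evolve-periodic y q = trans (inducedMap-at f y q) (trans (f≗ _) (localRule-window (periodic y) q))
    same-image : ∀ q → evolve (periodic x) q ≡ evolve (periodic x′) q
    same-image q = trans (sym (evolve-periodic x q))
                         (trans (cong (λ y → lookup y (q mod suc n)) Fx≡Fx′) (evolve-periodic x′ q))
    agree : ∀ i → lookup x i ≡ lookup x′ i
    agree i = begin
      lookup x i                   ≡⟨ periodic-lookup x i ⟨
      periodic x (toℕ i + suc n)   ≡⟨ Injectivity.agree-beyond mirror (periodic x) (periodic x′) same-image t t∈S u v t≡a
                                        (toℕ i + suc n) (≤-trans 2a≤n (m≤n+m _ _)) ⟩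
      periodic x′ (toℕ i + suc n)  ≡⟨ periodic-lookup x′ i ⟩
      lookup x′ i                  ∎

  localRule-bijective : ∀ {f} → f ≗ localRule S ia ib → ReflectionClosed S (a + b) →
    (t : Fin k) → lookup S t ≡ true → ∀ u v → toℕ t + u * Ξ ≡ a + v * Ξ →
    ∀ n → a + a ≤ n → Bijective _≡_ _≡_ (inducedMap n f)
  localRule-bijective {f} f≗ mirror t t∈S u v t≡a n 2a≤n =
    injective , Vec-Bool-injective⇒surjective (inducedMap n f) injective
    where
    injective : Injective _≡_ _≡_ (inducedMap n f)
    injective = localRule-injective f≗ mirror t t∈S u v t≡a n 2a≤n

localRule-dependsOn : ∀ {k} (S : Vec Bool k) {ia ib e : Fin k} {f} → f ≗ localRule S ia ib →
  ia ≢ ib → lookup S ib ≢ true → lookup S e ≡ true → e ≢ ia → e ≢ ib → DependsOn f e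
localRule-dependsOn {k} S {ia} {ib} {e} {f} f≗ ia≢ib ib∉S e∈S e≢ia e≢ib =
  x₀ , λ f[x₀]≡f[x₁] → not-¬ f[x₀]≡false (trans f[x₀]≡f[x₁] f[x₁]≡true)
  where
  x₀ x₁ : Vec Bool k
  x₀ = replicate k true [ ib ]%= not
  x₁ = x₀ [ e ]%= not
  x₀-off-ib : ∀ i → i ≢ ib → lookup x₀ i ≡ true
  x₀-off-ib i i≢ib = trans (lookup∘updateAt′ i ib i≢ib (replicate k true)) (lookup-replicate i true)
  x₀-ib : lookup x₀ ib ≡ false
  x₀-ib = trans (lookup∘updateAt ib (replicate k true)) (cong not (lookup-replicate ib true))
  x₀-on-S : ∀ i → lookup S i ≡ true → lookup x₀ i ≡ true
  x₀-on-S i i∈S = x₀-off-ib i λ i≡ib → ib∉S (subst (λ j → lookup S j ≡ true) i≡ib i∈S)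
  x₁-off-e : ∀ i → i ≢ e → lookup x₁ i ≡ lookup x₀ i
  x₁-off-e i i≢e = lookup∘updateAt′ i e i≢e x₀
  x₁-e : lookup x₁ e ≡ false
  x₁-e = trans (lookup∘updateAt e x₀) (cong not (x₀-on-S e e∈S))
  localRule-≡ : ∀ w {x y p} → lookup w ia ≡ x → lookup w ib ≡ y → prodOver S w ≡ p → f w ≡ x xor (not y ∧ p)
  localRule-≡ w refl refl refl = f≗ w
  f[x₀]≡false : f x₀ ≡ false
  f[x₀]≡false = localRule-≡ x₀ (x₀-off-ib ia ia≢ib) x₀-ib (prodOver-true⇐ S x₀ x₀-on-S)
  f[x₁]≡true : f x₁ ≡ true
  f[x₁]≡true = localRule-≡ x₁ (trans (x₁-off-e ia (≢-sym e≢ia)) (x₀-off-ib ia ia≢ib))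
                              (trans (x₁-off-e ib (≢-sym e≢ib)) x₀-ib)
                              (prodOver-false S x₁ e e∈S x₁-e)

toℕ-≢ : ∀ {n} {i j : Fin n} {m m′} → toℕ i ≡ m → toℕ j ≡ m′ → m ≢ m′ → i ≢ j
toℕ-≢ refl refl m≢m′ i≡j = m≢m′ (cong toℕ i≡j)

opposite-complement : ∀ {k} {i j : Fin (suc k)} → toℕ i + toℕ j ≡ k → opposite i ≡ j
opposite-complement {i = i} {j} i+j≡k =
  toℕ-injective (+-cancelˡ-≡ (toℕ i) _ _ (trans (toℕ-i+toℕ-opposite-i i) (sym i+j≡k)))

localRule-hasDiameter : ∀ {a b} (S : Vec Bool (suc (a + b))) {ia ib : Fin (suc (a + b))} {f} → f ≗ localRule S ia ib →
  toℕ ia ≡ a → toℕ ib ≡ b → 0 < a → a < b →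
  Symmetric S → lookup S fzero ≡ true → lookup S ia ≢ true → HasDiameter f
localRule-hasDiameter {a} {b} S {ia} {ib} f≗ toℕ-ia toℕ-ib 0<a a<b sym-S 0∈S ia∉S =
  localRule-dependsOn S f≗ ia≢ib ib∉S 0∈S (toℕ-≢ refl toℕ-ia (<⇒≢ℕ 0<a)) (toℕ-≢ refl toℕ-ib (<⇒≢ℕ 0<b)) ,
  localRule-dependsOn S f≗ ia≢ib ib∉S (trans (sym (sym-S fzero)) 0∈S)
    (toℕ-≢ (toℕ-fromℕ (a + b)) toℕ-ia (≢-sym (<⇒≢ℕ (m<m+n a 0<b))))
    (toℕ-≢ (toℕ-fromℕ (a + b)) toℕ-ib (≢-sym (<⇒≢ℕ (m<n+m b 0<a))))
  where
  0<b : 0 < b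
  0<b = <-trans 0<a a<b
  ia≢ib : ia ≢ ib
  ia≢ib = toℕ-≢ toℕ-ia toℕ-ib (<⇒≢ℕ a<b)
  opposite-ib : opposite ib ≡ ia
  opposite-ib = opposite-complement (trans (cong₂ _+_ toℕ-ib toℕ-ia) (+-comm b a))
  ib∉S : lookup S ib ≢ true
  ib∉S ib∈S = ia∉S (trans (cong (lookup S) (sym opposite-ib)) (trans (sym (sym-S ib)) ib∈S))

theF≗localRule : ∀ {a b} (S : Vec Bool (suc (a + b))) →
  theF (suc (a + b)) (suc a) S ≗ localRule S (a mod suc (a + b)) (b mod suc (a + b))
theF≗localRule {a} {b} S w =
  cong (λ y → lookup w (a mod suc (a + b)) xor (y ∧ prodOver S w))
       (trans (cong (λ l → coord w l xor true) position) (xor-comm _ true))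
  where
  position : a + b + 1 ∸ a ≡ suc b
  position = trans (cong (_∸ a) (+-assoc a b 1)) (trans (m+n∸m≡n a (b + 1)) (+-comm b 1))

theF-isLifting : ∀ {k a Ξ} → a + (a + Ξ) ≡ k → 0 < a → 0 < Ξ →
  (S : Vec Bool (suc k)) → Symmetric S → lookup S fzero ≡ true → ¬ (suc a ∈ₗ S) →
  (t : Fin (suc k)) → lookup S t ≡ true → ∀ u v → toℕ t + u * Ξ ≡ a + v * Ξ →
  ∀ n → suc k ≤ n → IsLifting (suc k) n (theF (suc k) (suc a) S)
theF-isLifting {a = a} {Ξ} refl 0<a 0<Ξ S sym-S 0∈S j∉S t t∈S u v t≡a n k<n =
  k<n ,
  localRule-hasDiameter S f≗ toℕ-ia toℕ-ib 0<a (m<m+n a 0<Ξ) sym-S 0∈S (λ ia∈S → j∉S (_ , cong suc toℕ-ia , ia∈S)) ,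
  localRule-bijective S toℕ-ia toℕ-ib f≗ (symmetric⇒reflectionClosed {S = S} sym-S) t t∈S u v t≡a n 2a≤n
  where
  b : ℕ
  b = a + Ξ
  toℕ-ia : toℕ (a mod suc (a + b)) ≡ a
  toℕ-ia = toℕ-mod (m≤m+n a b)
  toℕ-ib : toℕ (b mod suc (a + b)) ≡ b
  toℕ-ib = toℕ-mod (m≤n+m b a)
  f≗ : theF (suc (a + b)) (suc a) S ≗ localRule S (a mod suc (a + b)) (b mod suc (a + b))
  f≗ = theF≗localRule {a} {b} S
  2a≤n : a + a ≤ n
  2a≤n = ≤-trans (+-monoʳ-≤ a (m≤m+n a Ξ)) (≤-trans (n≤1+n _) k<n)

half-split : ∀ a {k} → 2 * suc a ≤ suc k → a + (a + suc (suc k ∸ 2 * suc a)) ≡ k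
half-split a {k} 2j≤k = suc-injective (trans (regroup a (suc k ∸ 2 * suc a)) (m+[n∸m]≡n 2j≤k))
  where
  regroup : ∀ a d → suc (a + (a + suc d)) ≡ 2 * suc a + d
  regroup = solve-∀

1∈ₗ⇒lookup-zero : ∀ {k} {S : Vec Bool (suc k)} → 1 ∈ₗ S → lookup S fzero ≡ true
1∈ₗ⇒lookup-zero (fzero , _  , 0∈S) = 0∈S
1∈ₗ⇒lookup-zero (fsuc _ , () , _)

mainTheorem5 : (k j : ℕ) → 2 ≤ j → 2 * j ≤ k → (S : Vec Bool k) →
    Symmetric S → 1 ∈ₗ S → ¬ (j ∈ₗ S) →
    (∃ λ t → t ∈ₗ S × t % suc (k ∸ 2 * j) ≡ j % suc (k ∸ 2 * j)) →
    (n : ℕ) → k ≤ n → IsLifting k n (theF k j S)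
mainTheorem5 zero    (suc (suc _)) (s≤s (s≤s z≤n)) ()
mainTheorem5 (suc k) (suc a@(suc _)) (s≤s (s≤s z≤n)) 2j≤k S sym-S 1∈S j∉S (_ , (t , refl , t∈S) , t≡j) =
  theF-isLifting {Ξ = Ξ} (half-split a 2j≤k) (s≤s z≤n) (s≤s z≤n) S sym-S (1∈ₗ⇒lookup-zero {S = S} 1∈S) j∉S t t∈S
    (suc a / Ξ) (suc (toℕ t) / Ξ) (suc-injective (m%n≡o%n⇒m+[o/n]*n≡o+[m/n]*n (suc (toℕ t)) (suc a) Ξ t≡j))
  where
  Ξ : ℕ
  Ξ = suc (suc k ∸ 2 * suc a)
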